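{- Let $P,Q$ be posets, $f\in\mathrm{Pro}(P,Q)$ and $g=Df\in\mathrm{Pro}(Q,P)$. Let $(I,F)$ be the cut of $Q\times P^{op}$ associated to $f$, namely $I=\{(q,p):q\in f(p)\}$, $F=\{(q,p):q\notin f(p)\}$, and $(J,G)$ the cut of $P\times Q^{op}$ associated to $g$. Then (a) $(J,G)=(F^{op},I^{op})$, and (c) $\Gamma g=(\Lambda f)^{op}$ and $\Lambda g=(\Gamma f)^{op}$.
   Context: $\widehat{Q}$ is the set of down-sets of $Q$ ordered by inclusion. A profunctor $f:P\to Q$ is an order-preserving map $f:P\to\widehat{Q}$. $D:\mathrm{Pro}(P,Q)\to\mathrm{Pro}(Q,P)$ is $Df(q)=\{p\in P: q\notin f(p)\}$. For $f\in\mathrm{Pro}(P,Q)$: $\Lambda f=\{(q,p)\in Q\times P : q\in f(p),\ q\notin f(p')\ \forall p'<p\}$ and $\Gamma f=\{(q,p)\in Q\times P: q\text{ minimal in } Q\setminus f(p)\}$; for $g\in\mathrm{Pro}(Q,P)$ these are defined symmetrically as subsets of $P\times Q$. For $X\subseteq Q\times P$, $X^{op}=\{(p,q):(q,p)\in X\}$. -}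

module Defs where

open import Level using (Level; _⊔_; suc)
open import Data.Product using (_×_; _,_; proj₁; proj₂)
open import Relation.Nullary using (¬_)
open import Relation.Unary using (Pred; _∈_; _∉_; _⊆_)
open import Relation.Binary.Bundles using (Poset)

record DownSet {c ℓ₁ ℓ₂ : Level} (Q : Poset c ℓ₁ ℓ₂) (ℓ : Level)
       : Set (c ⊔ ℓ₂ ⊔ suc ℓ) where
  open Poset Q
  field
    mem    : Pred Carrier ℓ
    closed : ∀ {x y} → x ≤ y → y ∈ mem → x ∈ mem
open DownSet public

_⊆D_ : ∀ {c ℓ₁ ℓ₂ ℓ} {Q : Poset c ℓ₁ ℓ₂} → DownSet Q ℓ → DownSet Q ℓ → Set _
A ⊆D B = mem A ⊆ mem B

-- A profunctor P → Q: an order-preserving map P → Q-hat.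
record Pro {c ℓ₁ ℓ₂ : Level} (P Q : Poset c ℓ₁ ℓ₂) (ℓ : Level)
       : Set (c ⊔ ℓ₂ ⊔ suc ℓ) where
  field
    app  : Poset.Carrier P → DownSet Q ℓ
    mono : ∀ {x y} → Poset._≤_ P x y → app x ⊆D app y
open Pro public


module _ {c ℓ₁ ℓ₂ ℓ : Level} {P Q : Poset c ℓ₁ ℓ₂} where
  private
    module P = Poset P
    module Q = Poset Q

  D : Pro P Q ℓ → Pro Q P ℓ
  app (D f) q = record
    { mem    = λ p → q ∉ mem (app f p)
    ; closed = λ p≤p' q∉fp' q∈fp → q∉fp' (mono f p≤p' q∈fp)
    }
  mono (D f) q≤q' q∉fp q'∈fp = q∉fp (closed (app f _) q≤q' q'∈fp)

  cutI : Pro P Q ℓ → Pred (Q.Carrier × P.Carrier) ℓ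
  cutI f (q , p) = q ∈ mem (app f p)

  cutF : Pro P Q ℓ → Pred (Q.Carrier × P.Carrier) ℓ
  cutF f (q , p) = q ∉ mem (app f p)

  Λ : Pro P Q ℓ → Pred (Q.Carrier × P.Carrier) (c ⊔ ℓ₁ ⊔ ℓ₂ ⊔ ℓ)
  Λ f (q , p) = q ∈ mem (app f p)
              × (∀ p' → p' P.≤ p → ¬ (p' P.≈ p) → q ∉ mem (app f p'))

  -- Γ f = {(q,p) : q minimal in Q ∖ f(p)}
  Γ : Pro P Q ℓ → Pred (Q.Carrier × P.Carrier) (c ⊔ ℓ₁ ⊔ ℓ₂ ⊔ ℓ)
  Γ f (q , p) = q ∉ mem (app f p)
              × (∀ q' → q' Q.≤ q → ¬ (q' Q.≈ q) → ¬ (q' ∉ mem (app f p)))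

_ᵒᵖ : ∀ {a b ℓ} {A : Set a} {B : Set b} → Pred (A × B) ℓ → Pred (B × A) ℓ
(X ᵒᵖ) (p , q) = X (q , p)

-- D f is the complement of f read in the other direction, so the cut of D f is the cut of f with
-- its halves swapped and transposed; Λ and Γ pick minimal points of these halves (in P, resp. Q),
-- so they are exchanged as well. Excluded middle is needed only where membership in the upper
-- half of the cut of D f, a double negation of membership in f, must be turned into membership.
module Submission where

open import Defs
open import Level using (Level)
open import Data.Product using (_×_; _,_)
open import Relation.Unary using (_≐_; _⊆_)
open import Relation.Binary.Bundles using (Poset)
open import Axiom.ExcludedMiddle using (ExcludedMiddle)
open import Axiom.DoubleNegationElimination using (DoubleNegationElimination; em⇒dne)

module _ {c ℓ₁ ℓ₂ ℓ : Level} {P Q : Poset c ℓ₁ ℓ₂} (f : Pro P Q ℓ) where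

  cutI-D : cutI (D f) ≐ cutF f ᵒᵖ
  cutI-D = (λ q∉fp → q∉fp) , (λ q∉fp → q∉fp)

  cutF-D : DoubleNegationElimination ℓ → cutF (D f) ≐ cutI f ᵒᵖ
  cutF-D dne = dne , (λ q∈fp q∉fp → q∉fp q∈fp)

  Λ-D : Λ (D f) ≐ Γ f ᵒᵖ
  Λ-D = (λ q∈Γ → q∈Γ) , (λ q∈Γ → q∈Γ)

  Γ-D : DoubleNegationElimination ℓ → Γ (D f) ≐ Λ f ᵒᵖ
  Γ-D dne = Γ⇒Λ , Λ⇒Γ
    where
    Γ⇒Λ : Γ (D f) ⊆ Λ f ᵒᵖ
    Γ⇒Λ (¬q∉fp , minimal) =
      dne ¬q∉fp , λ p' p'≤p p'≉p q∈fp' → minimal p' p'≤p p'≉p (λ q∉fp' → q∉fp' q∈fp')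

    Λ⇒Γ : Λ f ᵒᵖ ⊆ Γ (D f)
    Λ⇒Γ (q∈fp , minimal) =
      (λ q∉fp → q∉fp q∈fp) , λ p' p'≤p p'≉p ¬q∉fp' → ¬q∉fp' (minimal p' p'≤p p'≉p)

corollary3p6 : ∀ {c ℓ₁ ℓ₂ ℓ} → ExcludedMiddle ℓ →
    (P Q : Poset c ℓ₁ ℓ₂) (f : Pro P Q ℓ) →
    let g = D f in
    ((cutI g ≐ (cutF f) ᵒᵖ) × (cutF g ≐ (cutI f) ᵒᵖ))
    × ((Γ g ≐ (Λ f) ᵒᵖ) × (Λ g ≐ (Γ f) ᵒᵖ))
corollary3p6 em P Q f = (cutI-D f , cutF-D f dne) , (Γ-D f dne , Λ-D f)
  where dne = em⇒dne em
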